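{- Let $n$ be a positive integer and let $G=P_3\Box P_n$. There is no path cover $\mathcal P$ of $G$ such that, for some odd integer $k\in[n]$, we have $(2,k)\in\mathcal E(\mathcal P)$ and $\mathcal E(\mathcal P)\subseteq \{2\}\times([n]\setminus[k-1])$.
   Context: For a positive integer $m$, $[m]=\{1,\dots,m\}$ and $[0]=\emptyset$. $P_m$ denotes the path with vertex set $[m]$ and edges $\{i,i+1\}$ for $1\le i<m$. The Cartesian product $G\Box H$ has vertex set $V(G)\times V(H)$, with $(g_1,h_1)$ adjacent to $(g_2,h_2)$ iff either $g_1=g_2$ and $h_1h_2\in E(H)$, or $g_1g_2\in E(G)$ and $h_1=h_2$. So vertices of $P_3\Box P_n$ are pairs $(x,y)$ with $x\in[3]$, $y\in[n]$. A path cover (path factor) of a graph $G$ is a set $\mathcal P$ of pairwise vertex-disjoint paths in $G$, each with at least two vertices, whose vertex sets together cover $V(G)$. $\mathcal E(\mathcal P)$ denotes the set of endvertices of the paths in $\mathcal P$. -}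

module Defs where

open import Data.Nat using (ℕ; suc; _≤_; _*_; _+_)
open import Data.Product using (_×_; _,_; Σ; ∃; proj₁; proj₂)
open import Data.Sum using (_⊎_)
open import Data.List using (List; _∷_; _∷ʳ_; length; concat)
open import Data.List.Relation.Unary.All using (All)
open import Data.List.Relation.Unary.Any using (Any)
open import Data.List.Relation.Unary.Linked using (Linked)
open import Data.List.Relation.Unary.Unique.Propositional using (Unique)
open import Data.List.Membership.Propositional using (_∈_)
open import Relation.Binary.PropositionalEquality using (_≡_)

Vertex : Set
Vertex = ℕ × ℕ

InGrid : ℕ → Vertex → Set
InGrid n (x , y) = (1 ≤ x × x ≤ 3) × (1 ≤ y × y ≤ n)

Adj : Vertex → Vertex → Set
Adj (x₁ , y₁) (x₂ , y₂) =
  (x₁ ≡ x₂ × (y₂ ≡ suc y₁ ⊎ y₁ ≡ suc y₂))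
  ⊎ (y₁ ≡ y₂ × (x₂ ≡ suc x₁ ⊎ x₁ ≡ suc x₂))

-- A path in P_3 □ P_n with at least two vertices, given by its vertex
-- sequence: all vertices in the graph, consecutive ones adjacent.
-- (Distinctness of its vertices is imposed in PathCover via Unique.)
IsPathIn : ℕ → List Vertex → Set
IsPathIn n p = (2 ≤ length p) × All (InGrid n) p × Linked Adj p

-- A path cover of P_3 □ P_n: a family of paths (each with ≥ 2 vertices)
-- which are pairwise vertex-disjoint, each with distinct vertices
-- (jointly: the concatenation has no repetition), covering all vertices.
PathCover : ℕ → List (List Vertex) → Set
PathCover n ps =
  All (IsPathIn n) ps
  × Unique (concat ps)
  × (∀ v → InGrid n v → v ∈ concat ps)

IsEndOfPath : Vertex → List Vertex → Set
IsEndOfPath v p = (∃ λ rest → p ≡ v ∷ rest) ⊎ (∃ λ ini → p ≡ ini ∷ʳ v)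

IsEnd : Vertex → List (List Vertex) → Set
IsEnd v ps = Any (IsEndOfPath v) ps

Odd : ℕ → Set
Odd k = ∃ λ m → k ≡ 2 * m + 1

-- Follow the path-edges of the cover row by row. No vertex below row k or in an
-- outer column is an endvertex, so each has exactly two path-neighbours, and the
-- corners of row 1 force both outer columns to continue upwards while the
-- middle one does not. From then on the pattern of vertical path-edges between
-- consecutive rows alternates: on the way from an odd row to the next one
-- exactly the two outer columns are used, on the way from an even row exactly
-- the middle column and one outer column (were the middle vertex joined to both
-- outer vertices instead, no path-edge would leave the rows below, and the path
-- through (1,1) would have an endvertex there). As k is odd, the vertical
-- path-edges entering row k are of the second kind; the outer vertex of row k
-- without a path-edge below is then joined to (2,k), which thus gets a second
-- path-neighbour besides (2,k-1), although it is an endvertex.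
module Submission where

open import Defs
open import Data.Nat using (ℕ; zero; suc; _≤_; _<_; _*_; _+_; z≤n; s≤s)
open import Data.Nat.Properties
  using (≤-trans; ≤-<-trans; <⇒≤; <⇒≱; n≤1+n; +-suc; m≤n⇒m<n∨m≡n; ≤-reflexive)
open import Data.Product using (_×_; _,_; proj₁; proj₂; ∃; ∃₂)
open import Data.Sum using (_⊎_; inj₁; inj₂; [_,_]′)
import Data.Sum as Sum
open import Data.List using (List; []; _∷_; _++_; _∷ʳ_; concat)
open import Data.List.Relation.Unary.All as All using (All; _∷_)
import Data.List.Relation.Unary.All.Properties as All
open import Data.List.Relation.Unary.Any as Any using (Any; here; there)
open import Data.List.Relation.Unary.Linked using (Linked; [-]; _∷_)
open import Data.List.Relation.Unary.AllPairs using ([]; _∷_)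
open import Data.List.Relation.Unary.Unique.Propositional using (Unique)
open import Data.List.Relation.Binary.Disjoint.Propositional using (Disjoint)
open import Data.List.Membership.Propositional using (_∈_; _∉_; find; lose)
open import Data.List.Membership.Propositional.Properties
  using (∈-++⁺ʳ; ∈-concat⁺; ∈-concat⁻′)
open import Data.Empty using (⊥; ⊥-elim)
open import Function using (_∘_)
open import Relation.Nullary using (¬_)
open import Relation.Binary.PropositionalEquality
  using (_≡_; _≢_; refl; sym; trans; cong; subst)

data Consecutive {A : Set} (u v : A) : List A → Set where
  here  : ∀ {l} → Consecutive u v (u ∷ v ∷ l)
  there : ∀ {x l} → Consecutive u v l → Consecutive u v (x ∷ l)

Link : {A : Set} → A → A → List A → Set
Link u v l = Consecutive u v l ⊎ Consecutive v u l

PathEdge : {A : Set} → List (List A) → A → A → Set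
PathEdge ps u v = Any (Link u v) ps

module _ {A : Set} where

  private variable
    u v a b c x : A
    l p xs ys : List A
    ps : List (List A)

  Consecutive⇒∈ˡ : Consecutive u v l → u ∈ l
  Consecutive⇒∈ˡ here      = here refl
  Consecutive⇒∈ˡ (there c) = there (Consecutive⇒∈ˡ c)

  Consecutive⇒∈ʳ : Consecutive u v l → v ∈ l
  Consecutive⇒∈ʳ here      = there (here refl)
  Consecutive⇒∈ʳ (there c) = there (Consecutive⇒∈ʳ c)

  Link⇒∈ : Link u v l → u ∈ l
  Link⇒∈ = [ Consecutive⇒∈ˡ , Consecutive⇒∈ʳ ]′

  Consecutive-++⁺ˡ : ∀ ys → Consecutive u v xs → Consecutive u v (xs ++ ys)
  Consecutive-++⁺ˡ ys here      = here
  Consecutive-++⁺ˡ ys (there c) = there (Consecutive-++⁺ˡ ys c)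

  Consecutive-++⁺ʳ : ∀ xs → Consecutive u v ys → Consecutive u v (xs ++ ys)
  Consecutive-++⁺ʳ []       c = c
  Consecutive-++⁺ʳ (x ∷ xs) c = there (Consecutive-++⁺ʳ xs c)

  Consecutive-concat⁺ : p ∈ ps → Consecutive u v p → Consecutive u v (concat ps)
  Consecutive-concat⁺ {ps = p ∷ ps} (here refl) c = Consecutive-++⁺ˡ (concat ps) c
  Consecutive-concat⁺ {ps = q ∷ ps} (there m)   c = Consecutive-++⁺ʳ q (Consecutive-concat⁺ m c)

  Consecutive-into-head⇒∈ : Consecutive u v (v ∷ l) → v ∈ l
  Consecutive-into-head⇒∈ here      = here refl
  Consecutive-into-head⇒∈ (there c) = Consecutive⇒∈ʳ c

  Consecutive-from-last⇒∈ : ∀ xs → Consecutive v u (xs ∷ʳ v) → v ∈ xs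
  Consecutive-from-last⇒∈ []           (there ())
  Consecutive-from-last⇒∈ (x ∷ [])     here               = here refl
  Consecutive-from-last⇒∈ (x ∷ [])     (there (there ()))
  Consecutive-from-last⇒∈ (x ∷ y ∷ xs) here               = here refl
  Consecutive-from-last⇒∈ (x ∷ y ∷ xs) (there c)          =
    there (Consecutive-from-last⇒∈ (y ∷ xs) c)

  head-of-backward-closed : {P : A → Set} {h : A} →
    (∀ {x y} → Consecutive x y (h ∷ l) → P y → P x) → v ∈ h ∷ l → P v → P h
  head-of-backward-closed              step (here refl) pv = pv
  head-of-backward-closed {l = y ∷ l}  step (there m)   pv =
    step here (head-of-backward-closed (step ∘ there) m pv)

  Linked⇒Consecutive : {R : A → A → Set} → Linked R l → Consecutive u v l → R u v
  Linked⇒Consecutive (r ∷ _)  here      = r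
  Linked⇒Consecutive (_ ∷ rs) (there c) = Linked⇒Consecutive rs c
  Linked⇒Consecutive [-]      (there ())

  head∉tail : Unique (x ∷ l) → x ∉ l
  head∉tail (x∉ ∷ _) m = All.lookup x∉ m refl

  Unique-++⁻ : ∀ xs → Unique (xs ++ ys) → Unique xs × Unique ys × Disjoint xs ys
  Unique-++⁻ []       u        = [] , u , λ { (() , _) }
  Unique-++⁻ (x ∷ xs) (x∉ ∷ u) with Unique-++⁻ xs u
  ... | uxs , uys , disjoint = All.++⁻ˡ xs x∉ ∷ uxs , uys , λ where
    (here refl , m) → All.lookup x∉ (∈-++⁺ʳ xs m) refl
    (there m′ , m)  → disjoint (m′ , m)

  Consecutive-functional : Unique l → Consecutive v a l → Consecutive v b l → a ≡ b
  Consecutive-functional _       here      here      = refl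
  Consecutive-functional u       here      (there c) = ⊥-elim (head∉tail u (Consecutive⇒∈ˡ c))
  Consecutive-functional u       (there c) here      = ⊥-elim (head∉tail u (Consecutive⇒∈ˡ c))
  Consecutive-functional (_ ∷ u) (there c) (there d) = Consecutive-functional u c d

  Consecutive-injective : Unique l → Consecutive a v l → Consecutive b v l → a ≡ b
  Consecutive-injective _       here      here      = refl
  Consecutive-injective (_ ∷ u) here      (there c) = ⊥-elim (head∉tail u (Consecutive-into-head⇒∈ c))
  Consecutive-injective (_ ∷ u) (there c) here      = ⊥-elim (head∉tail u (Consecutive-into-head⇒∈ c))
  Consecutive-injective (_ ∷ u) (there c) (there d) = Consecutive-injective u c d

  Consecutive-asym : Unique l → Consecutive u v l → ¬ Consecutive v u l
  Consecutive-asym u       here      here      = head∉tail u (here refl)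
  Consecutive-asym u       here      (there c) = head∉tail u (Consecutive⇒∈ʳ c)
  Consecutive-asym u       (there c) here      = head∉tail u (Consecutive⇒∈ʳ c)
  Consecutive-asym (_ ∷ u) (there c) (there d) = Consecutive-asym u c d

  -- Two of the three links run in the same direction.
  Link-atMostTwo : Unique l → Link v a l → Link v b l → Link v c l → a ≡ b ⊎ a ≡ c ⊎ b ≡ c
  Link-atMostTwo u (inj₁ x) (inj₁ y) _        = inj₁ (Consecutive-functional u x y)
  Link-atMostTwo u (inj₂ x) (inj₂ y) _        = inj₁ (Consecutive-injective u x y)
  Link-atMostTwo u (inj₁ x) (inj₂ _) (inj₁ z) = inj₂ (inj₁ (Consecutive-functional u x z))
  Link-atMostTwo u (inj₁ _) (inj₂ y) (inj₂ z) = inj₂ (inj₂ (Consecutive-injective u y z))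
  Link-atMostTwo u (inj₂ _) (inj₁ y) (inj₁ z) = inj₂ (inj₂ (Consecutive-functional u y z))
  Link-atMostTwo u (inj₂ x) (inj₁ _) (inj₂ z) = inj₂ (inj₁ (Consecutive-injective u x z))

  head-Link⇒Consecutive : Unique (v ∷ l) → Link v a (v ∷ l) → Consecutive v a (v ∷ l)
  head-Link⇒Consecutive _ (inj₁ c) = c
  head-Link⇒Consecutive u (inj₂ c) = ⊥-elim (head∉tail u (Consecutive-into-head⇒∈ c))

  last-Link⇒Consecutive : ∀ xs → Unique (xs ∷ʳ v) → Link v a (xs ∷ʳ v) → Consecutive a v (xs ∷ʳ v)
  last-Link⇒Consecutive xs u (inj₁ c) =
    ⊥-elim (proj₂ (proj₂ (Unique-++⁻ xs u)) (Consecutive-from-last⇒∈ xs c , here refl))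
  last-Link⇒Consecutive xs u (inj₂ c) = c

  PathEdge-sym : PathEdge ps u v → PathEdge ps v u
  PathEdge-sym = Any.map Sum.swap

  PathEdge⇒∈ : PathEdge ps u v → u ∈ concat ps
  PathEdge⇒∈ = ∈-concat⁺ ∘ Any.map Link⇒∈

  PathEdge⇒Link-concat : PathEdge ps u v → Link u v (concat ps)
  PathEdge⇒Link-concat e with find e
  ... | _ , p∈ps , link = Sum.map (Consecutive-concat⁺ p∈ps) (Consecutive-concat⁺ p∈ps) link

  PathEdge-atMostTwo : Unique (concat ps) →
    PathEdge ps v a → PathEdge ps v b → PathEdge ps v c → a ≡ b ⊎ a ≡ c ⊎ b ≡ c
  PathEdge-atMostTwo u x y z =
    Link-atMostTwo u (PathEdge⇒Link-concat x) (PathEdge⇒Link-concat y) (PathEdge⇒Link-concat z)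

  PathEdge-here⁻ : Unique (p ++ concat ps) → v ∈ p → PathEdge (p ∷ ps) v a → Link v a p
  PathEdge-here⁻ _ _   (here link) = link
  PathEdge-here⁻ {p = p} u v∈p (there e) =
    ⊥-elim (proj₂ (proj₂ (Unique-++⁻ p u)) (v∈p , PathEdge⇒∈ e))

  PathEdge-there⁻ : Unique (p ++ concat ps) → v ∈ concat ps → PathEdge (p ∷ ps) v a → PathEdge ps v a
  PathEdge-there⁻ {p = p} u v∈ps (here link) =
    ⊥-elim (proj₂ (proj₂ (Unique-++⁻ p u)) (Link⇒∈ link , v∈ps))
  PathEdge-there⁻ _ _ (there e) = e

private variable
  u v w a b c : Vertex
  p : List Vertex
  ps : List (List Vertex)

IsEndOfPath⇒∈ : IsEndOfPath v p → v ∈ p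
IsEndOfPath⇒∈ (inj₁ (_ , refl))   = here refl
IsEndOfPath⇒∈ (inj₂ (ini , refl)) = ∈-++⁺ʳ ini (here refl)

∈⇒IsEndOfPath⊎between : v ∈ p → IsEndOfPath v p ⊎ ∃₂ λ a b → Consecutive a v p × Consecutive v b p
∈⇒IsEndOfPath⊎between (here refl) = inj₁ (inj₁ (_ , refl))
∈⇒IsEndOfPath⊎between {p = x ∷ p} (there v∈p) with ∈⇒IsEndOfPath⊎between v∈p
... | inj₁ (inj₁ ([] , refl))       = inj₁ (inj₂ (x ∷ [] , refl))
... | inj₁ (inj₁ (y ∷ rest , refl)) = inj₂ (x , y , here , there here)
... | inj₁ (inj₂ (ini , refl))      = inj₁ (inj₂ (x ∷ ini , refl))
... | inj₂ (a , b , a→v , v→b)      = inj₂ (a , b , there a→v , there v→b)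

IsEndOfPath⇒Link-unique : Unique p → IsEndOfPath v p → Link v a p → Link v b p → a ≡ b
IsEndOfPath⇒Link-unique u (inj₁ (_ , refl)) x y =
  Consecutive-functional u (head-Link⇒Consecutive u x) (head-Link⇒Consecutive u y)
IsEndOfPath⇒Link-unique u (inj₂ (ini , refl)) x y =
  Consecutive-injective u (last-Link⇒Consecutive ini u x) (last-Link⇒Consecutive ini u y)

IsEnd⇒PathEdge-unique : Unique (concat ps) → IsEnd v ps → PathEdge ps v a → PathEdge ps v b → a ≡ b
IsEnd⇒PathEdge-unique {ps = p ∷ _} u (here e) x y =
  IsEndOfPath⇒Link-unique (proj₁ (Unique-++⁻ p u)) e
    (PathEdge-here⁻ u (IsEndOfPath⇒∈ e) x) (PathEdge-here⁻ u (IsEndOfPath⇒∈ e) y)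
IsEnd⇒PathEdge-unique {ps = p ∷ ps} {v = v} u (there e) x y =
  IsEnd⇒PathEdge-unique (proj₁ (proj₂ (Unique-++⁻ p u))) e
    (PathEdge-there⁻ u v∈ps x) (PathEdge-there⁻ u v∈ps y)
  where
  v∈ps : v ∈ concat ps
  v∈ps = ∈-concat⁺ (Any.map IsEndOfPath⇒∈ e)

¬IsEnd⇒two-PathEdges : Unique (concat ps) → v ∈ concat ps → ¬ IsEnd v ps →
  ∃₂ λ a b → a ≢ b × PathEdge ps v a × PathEdge ps v b
¬IsEnd⇒two-PathEdges {ps = ps} u v∈ ¬end with ∈-concat⁻′ ps v∈
... | p , v∈p , p∈ps with ∈⇒IsEndOfPath⊎between v∈p
...   | inj₁ end = ⊥-elim (¬end (lose p∈ps end))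
...   | inj₂ (a , b , a→v , v→b) =
  a , b
  , (λ { refl → Consecutive-asym u (Consecutive-concat⁺ p∈ps a→v) (Consecutive-concat⁺ p∈ps v→b) })
  , lose p∈ps (inj₂ a→v) , lose p∈ps (inj₁ v→b)

Adj-sym : Adj u v → Adj v u
Adj-sym (inj₁ (refl , e)) = inj₁ (refl , Sum.swap e)
Adj-sym (inj₂ (refl , e)) = inj₂ (refl , Sum.swap e)

module PathCoverEdges {n : ℕ} {ps : List (List Vertex)} (cover : PathCover n ps) where

  infix 4 _~_
  _~_ : Vertex → Vertex → Set
  _~_ = PathEdge ps

  private
    unique : Unique (concat ps)
    unique = proj₁ (proj₂ cover)

  ~-sym : u ~ v → v ~ u
  ~-sym = PathEdge-sym

  ~⇒Adj×InGrid : u ~ v → Adj u v × InGrid n v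
  ~⇒Adj×InGrid e with find e
  ... | p , p∈ps , link with All.lookup (proj₁ cover) p∈ps
  ...   | _ , inGrid , linked with link
  ...     | inj₁ u→v = Linked⇒Consecutive linked u→v , All.lookup inGrid (Consecutive⇒∈ʳ u→v)
  ...     | inj₂ v→u = Adj-sym (Linked⇒Consecutive linked v→u) , All.lookup inGrid (Consecutive⇒∈ˡ v→u)

  ~⇒Adj : u ~ v → Adj u v
  ~⇒Adj = proj₁ ∘ ~⇒Adj×InGrid

  ~⇒InGridʳ : u ~ v → InGrid n v
  ~⇒InGridʳ = proj₂ ∘ ~⇒Adj×InGrid

  ~⇒InGridˡ : u ~ v → InGrid n u
  ~⇒InGridˡ = ~⇒InGridʳ ∘ ~-sym

  ~-unique-at-end : IsEnd v ps → v ~ a → v ~ b → a ≡ b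
  ~-unique-at-end = IsEnd⇒PathEdge-unique unique

  ~-third : v ~ a → v ~ b → a ≢ b → w ≢ a → w ≢ b → ¬ v ~ w
  ~-third x y a≢b w≢a w≢b z with PathEdge-atMostTwo unique z x y
  ... | inj₁ w≡a          = w≢a w≡a
  ... | inj₂ (inj₁ w≡b)   = w≢b w≡b
  ... | inj₂ (inj₂ a≡b)   = a≢b a≡b

  ~-both : InGrid n v → ¬ IsEnd v ps → (∀ {w} → v ~ w → w ≡ a ⊎ w ≡ b) → v ~ a × v ~ b
  ~-both inGrid ¬end only
    with ¬IsEnd⇒two-PathEdges unique (proj₂ (proj₂ cover) _ inGrid) ¬end
  ... | x , y , x≢y , v~x , v~y with only v~x | only v~y
  ... | inj₁ refl | inj₁ refl = ⊥-elim (x≢y refl)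
  ... | inj₁ refl | inj₂ refl = v~x , v~y
  ... | inj₂ refl | inj₁ refl = v~y , v~x
  ... | inj₂ refl | inj₂ refl = ⊥-elim (x≢y refl)

  ~-two-of-three : InGrid n v → ¬ IsEnd v ps → (∀ {w} → v ~ w → w ≡ a ⊎ w ≡ b ⊎ w ≡ c) →
    (v ~ a × v ~ b) ⊎ (v ~ a × v ~ c) ⊎ (v ~ b × v ~ c)
  ~-two-of-three inGrid ¬end only
    with ¬IsEnd⇒two-PathEdges unique (proj₂ (proj₂ cover) _ inGrid) ¬end
  ... | x , y , x≢y , v~x , v~y with only v~x | only v~y
  ... | inj₁ refl        | inj₁ refl        = ⊥-elim (x≢y refl)
  ... | inj₁ refl        | inj₂ (inj₁ refl) = inj₁ (v~x , v~y)
  ... | inj₁ refl        | inj₂ (inj₂ refl) = inj₂ (inj₁ (v~x , v~y))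
  ... | inj₂ (inj₁ refl) | inj₁ refl        = inj₁ (v~y , v~x)
  ... | inj₂ (inj₁ refl) | inj₂ (inj₁ refl) = ⊥-elim (x≢y refl)
  ... | inj₂ (inj₁ refl) | inj₂ (inj₂ refl) = inj₂ (inj₂ (v~x , v~y))
  ... | inj₂ (inj₂ refl) | inj₁ refl        = inj₂ (inj₁ (v~y , v~x))
  ... | inj₂ (inj₂ refl) | inj₂ (inj₁ refl) = inj₂ (inj₂ (v~y , v~x))
  ... | inj₂ (inj₂ refl) | inj₂ (inj₂ refl) = ⊥-elim (x≢y refl)

data Side : Set where
  left right : Side

col : Side → ℕ
col left  = 1
col right = 3

opposite : Side → Side
opposite left  = right
opposite right = left

Side-cases : ∀ s t → t ≡ s ⊎ t ≡ opposite s
Side-cases left  left  = inj₁ refl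
Side-cases left  right = inj₂ refl
Side-cases right left  = inj₂ refl
Side-cases right right = inj₁ refl

col≢2 : ∀ s → col s ≢ 2
col≢2 left  ()
col≢2 right ()

col-opposite≢col : ∀ s → col (opposite s) ≢ col s
col-opposite≢col left  ()
col-opposite≢col right ()

col-bounds : ∀ s → 1 ≤ col s × col s ≤ 3
col-bounds left  = s≤s z≤n , s≤s z≤n
col-bounds right = s≤s z≤n , s≤s (s≤s (s≤s z≤n))

outer-neighbours : ∀ {n s r} → Adj (col s , suc r) w → InGrid n w →
  w ≡ (col s , suc (suc r)) ⊎ w ≡ (col s , r) ⊎ w ≡ (2 , suc r)
outer-neighbours         (inj₁ (refl , inj₁ refl)) _ = inj₁ refl
outer-neighbours         (inj₁ (refl , inj₂ refl)) _ = inj₂ (inj₁ refl)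
outer-neighbours {s = left}  (inj₂ (refl , inj₁ refl)) _ = inj₂ (inj₂ refl)
outer-neighbours {s = left}  (inj₂ (refl , inj₂ refl)) ((() , _) , _)
outer-neighbours {s = right} (inj₂ (refl , inj₁ refl)) ((_ , s≤s (s≤s (s≤s ()))) , _)
outer-neighbours {s = right} (inj₂ (refl , inj₂ refl)) _ = inj₂ (inj₂ refl)

middle-neighbours : ∀ {r} → Adj (2 , suc r) w →
  w ≡ (2 , suc (suc r)) ⊎ w ≡ (2 , r) ⊎ w ≡ (col left , suc r) ⊎ w ≡ (col right , suc r)
middle-neighbours (inj₁ (refl , inj₁ refl)) = inj₁ refl
middle-neighbours (inj₁ (refl , inj₂ refl)) = inj₂ (inj₁ refl)
middle-neighbours (inj₂ (refl , inj₁ refl)) = inj₂ (inj₂ (inj₂ refl))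
middle-neighbours (inj₂ (refl , inj₂ refl)) = inj₂ (inj₂ (inj₁ refl))

2[1+m]+1≡2+[2m+1] : ∀ m → 2 * suc m + 1 ≡ suc (suc (2 * m + 1))
2[1+m]+1≡2+[2m+1] m = cong (λ x → suc (x + 1)) (+-suc m (m + 0))

module EndsInMiddleColumn
  {n : ℕ} {ps : List (List Vertex)} (cover : PathCover n ps) (n≥1 : 1 ≤ n)
  {k : ℕ} (k≤n : k ≤ n) (end-k : IsEnd (2 , k) ps)
  (ends : ∀ v → IsEnd v ps → proj₁ v ≡ 2 × (k ≤ proj₂ v × proj₂ v ≤ n)) where

  open PathCoverEdges cover

  private variable
    r R y : ℕ
    s : Side

  outer-¬end : ¬ IsEnd (col s , y) ps
  outer-¬end {s} e = col≢2 s (proj₁ (ends _ e))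

  below-k-¬end : ∀ {x} → y < k → ¬ IsEnd (x , y) ps
  below-k-¬end y<k e = <⇒≱ y<k (proj₁ (proj₂ (ends _ e)))

  ¬~-from-row0 : ∀ {x} → ¬ (x , 0) ~ w
  ¬~-from-row0 e with ~⇒InGridˡ e
  ... | _ , () , _

  outer-turns : ¬ (col s , r) ~ (col s , suc r) → suc r ≤ n →
    (col s , suc r) ~ (col s , suc (suc r)) × (col s , suc r) ~ (2 , suc r)
  outer-turns {s} {r} ¬down r<n = ~-both (col-bounds s , s≤s z≤n , r<n) outer-¬end only
    where
    only : (col s , suc r) ~ w → w ≡ (col s , suc (suc r)) ⊎ w ≡ (2 , suc r)
    only e with outer-neighbours (~⇒Adj e) (~⇒InGridʳ e)
    ... | inj₁ up           = inj₁ up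
    ... | inj₂ (inj₁ refl)  = ⊥-elim (¬down (~-sym e))
    ... | inj₂ (inj₂ mid)   = inj₂ mid

  outer-saturated : (col s , r) ~ (col s , suc r) → (col s , suc r) ~ (2 , suc r) →
    ¬ (col s , suc r) ~ (col s , suc (suc r))
  outer-saturated down mid = ~-third (~-sym down) mid (λ ()) (λ ()) (λ ())

  middle-continues : ¬ (2 , r) ~ (2 , suc r) → suc r < k →
    let m = (2 , suc r) in
    (m ~ (2 , suc (suc r)) × m ~ (col left , suc r))
    ⊎ (m ~ (2 , suc (suc r)) × m ~ (col right , suc r))
    ⊎ (m ~ (col left , suc r) × m ~ (col right , suc r))
  middle-continues {r} ¬down r<k =
    ~-two-of-three ((s≤s z≤n , s≤s (s≤s z≤n)) , s≤s z≤n , ≤-trans (<⇒≤ r<k) k≤n)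
      (below-k-¬end r<k) only
    where
    only : (2 , suc r) ~ w →
      w ≡ (2 , suc (suc r)) ⊎ w ≡ (col left , suc r) ⊎ w ≡ (col right , suc r)
    only e with middle-neighbours (~⇒Adj e)
    ... | inj₁ up          = inj₁ up
    ... | inj₂ (inj₁ refl) = ⊥-elim (¬down (~-sym e))
    ... | inj₂ (inj₂ side) = inj₂ side

  NoCrossing : ℕ → Set
  NoCrossing R = ∀ {x} → 1 ≤ x → x ≤ 3 → ¬ (x , R) ~ (x , suc R)

  NoCrossing-~-≤ : NoCrossing R → u ~ w → proj₂ u ≤ R → proj₂ w ≤ R
  NoCrossing-~-≤ {u = x , y} closed e y≤R with ~⇒Adj e
  ... | inj₂ (refl , _)         = y≤R
  ... | inj₁ (refl , inj₂ refl) = ≤-trans (n≤1+n _) y≤R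
  ... | inj₁ (refl , inj₁ refl) with m≤n⇒m<n∨m≡n y≤R
  ...   | inj₁ y<R  = y<R
  ...   | inj₂ refl = ⊥-elim (closed x≥1 x≤3 e)
    where
    x≥1 : 1 ≤ x
    x≥1 = proj₁ (proj₁ (~⇒InGridˡ e))
    x≤3 : x ≤ 3
    x≤3 = proj₂ (proj₁ (~⇒InGridˡ e))

  -- The path through (1,1) would stay in rows ≤ R, so its first vertex would
  -- be an endvertex below row k.
  ¬NoCrossing-below-k : 1 ≤ R → R < k → ¬ NoCrossing R
  ¬NoCrossing-below-k {R} R≥1 R<k closed
    with ∈-concat⁻′ ps (proj₂ (proj₂ cover) (1 , 1) ((s≤s z≤n , s≤s z≤n) , s≤s z≤n , n≥1))
  ... | h ∷ t , 11∈p , p∈ps = below-k-¬end (≤-<-trans h≤R R<k) (lose p∈ps (inj₁ (t , refl)))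
    where
    h≤R : proj₂ h ≤ R
    h≤R = head-of-backward-closed
      (λ x→y → NoCrossing-~-≤ closed (~-sym (lose p∈ps (inj₁ x→y)))) 11∈p R≥1

  OuterColumnsCross : ℕ → Set
  OuterColumnsCross r = (∀ s → (col s , r) ~ (col s , suc r)) × ¬ (2 , r) ~ (2 , suc r)

  MiddleColumnCrosses : ℕ → Set
  MiddleColumnCrosses r = (2 , r) ~ (2 , suc r) × ∃ λ s → ¬ (col s , r) ~ (col s , suc r)

  row1-outer : ∀ s → (col s , 1) ~ (col s , 2) × (col s , 1) ~ (2 , 1)
  row1-outer s = outer-turns ¬~-from-row0 n≥1

  outer-cross-at-1 : OuterColumnsCross 1
  outer-cross-at-1 =
    (λ s → proj₁ (row1-outer s))
    , ~-third (~-sym (proj₂ (row1-outer left))) (~-sym (proj₂ (row1-outer right))) (λ ()) (λ ()) (λ ())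

  k≢1 : k ≢ 1
  k≢1 refl with ~-unique-at-end end-k (~-sym (proj₂ (row1-outer left))) (~-sym (proj₂ (row1-outer right)))
  ... | ()

  outer→middle : OuterColumnsCross r → suc r < k → MiddleColumnCrosses (suc r)
  outer→middle {r} (outer , ¬mid) r<k with middle-continues ¬mid r<k
  ... | inj₁ (up , toL)          = up , left , outer-saturated {s = left} (outer left) (~-sym toL)
  ... | inj₂ (inj₁ (up , toR))   = up , right , outer-saturated {s = right} (outer right) (~-sym toR)
  ... | inj₂ (inj₂ (toL , toR))  = ⊥-elim (¬NoCrossing-below-k (s≤s z≤n) r<k closed)
    where
    closed : NoCrossing (suc r)
    closed {zero}                  ()
    closed {1}                     _ _ = outer-saturated {s = left} (outer left) (~-sym toL)
    closed {2}                     _ _ = ~-third toL toR (λ ()) (λ ()) (λ ())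
    closed {3}                     _ _ = outer-saturated {s = right} (outer right) (~-sym toR)
    closed {suc (suc (suc (suc _)))} _ (s≤s (s≤s (s≤s ())))

  middle→outer : MiddleColumnCrosses r → suc r < k → OuterColumnsCross (suc r)
  middle→outer {r} (midUp , s , ¬sUp) r<k = outer , ¬midUp
    where
    turn : (col s , suc r) ~ (col s , suc (suc r)) × (col s , suc r) ~ (2 , suc r)
    turn = outer-turns ¬sUp (≤-trans (<⇒≤ r<k) k≤n)

    s′ : Side
    s′ = opposite s

    ¬midUp : ¬ (2 , suc r) ~ (2 , suc (suc r))
    ¬midUp = ~-third (~-sym midUp) (~-sym (proj₂ turn)) (λ ()) (λ ()) (λ ())

    ¬mid→s′ : ¬ (2 , suc r) ~ (col s′ , suc r)
    ¬mid→s′ = ~-third (~-sym midUp) (~-sym (proj₂ turn)) (λ ()) (λ ())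
      (col-opposite≢col s ∘ cong proj₁)

    s′-up : (col s′ , suc r) ~ (col s′ , suc (suc r))
    s′-up = proj₁ (~-both (col-bounds s′ , s≤s z≤n , ≤-trans (<⇒≤ r<k) k≤n) outer-¬end only)
      where
      only : (col s′ , suc r) ~ w → w ≡ (col s′ , suc (suc r)) ⊎ w ≡ (col s′ , r)
      only e with outer-neighbours (~⇒Adj e) (~⇒InGridʳ e)
      ... | inj₁ up          = inj₁ up
      ... | inj₂ (inj₁ down) = inj₂ down
      ... | inj₂ (inj₂ refl) = ⊥-elim (¬mid→s′ (~-sym e))

    outer : ∀ t → (col t , suc r) ~ (col t , suc (suc r))
    outer t with Side-cases s t
    ... | inj₁ refl = proj₁ turn
    ... | inj₂ refl = s′-up

  ¬middle-crosses-into-k : MiddleColumnCrosses r → suc r ≢ k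
  ¬middle-crosses-into-k (midUp , s , ¬sUp) refl =
    col≢2 s (cong proj₁ (~-unique-at-end end-k (~-sym (proj₂ (outer-turns ¬sUp k≤n))) (~-sym midUp)))

  outer-cross-at-odd : ∀ m → 2 * m + 1 < k → OuterColumnsCross (2 * m + 1)
  outer-cross-at-odd zero    _  = outer-cross-at-1
  outer-cross-at-odd (suc m) lt =
    subst OuterColumnsCross (sym (2[1+m]+1≡2+[2m+1] m))
      (middle→outer (outer→middle (outer-cross-at-odd m (≤-trans (n≤1+n _) lt₁)) lt₁) lt₂)
    where
    lt₂ : suc (suc (2 * m + 1)) < k
    lt₂ = subst (_< k) (2[1+m]+1≡2+[2m+1] m) lt
    lt₁ : suc (2 * m + 1) < k
    lt₁ = ≤-trans (n≤1+n _) lt₂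

  k≢odd : ∀ m → k ≢ 2 * m + 1
  k≢odd zero    k≡1 = k≢1 k≡1
  k≢odd (suc m) k≡  =
    ¬middle-crosses-into-k (outer→middle (outer-cross-at-odd m (≤-trans (n≤1+n _) r<k)) r<k) (sym k≡′)
    where
    k≡′ : k ≡ suc (suc (2 * m + 1))
    k≡′ = trans k≡ (2[1+m]+1≡2+[2m+1] m)
    r<k : suc (2 * m + 1) < k
    r<k = ≤-reflexive (sym k≡′)

mainTheorem2 : (n : ℕ) → 1 ≤ n → (ps : List (List Vertex)) → PathCover n ps →
    (k : ℕ) → Odd k → 1 ≤ k → k ≤ n → IsEnd (2 , k) ps →
    (∀ v → IsEnd v ps → proj₁ v ≡ 2 × (k ≤ proj₂ v × proj₂ v ≤ n)) → ⊥
mainTheorem2 n n≥1 ps cover k (m , k≡2m+1) _ k≤n end-k ends =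
  EndsInMiddleColumn.k≢odd cover n≥1 k≤n end-k ends m k≡2m+1
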